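{- Let $G$ be a $(P_{3}\cup P_{1})$-free graph with $0<\tau(G)\le 1$, and let $S$ be a tough set of $G$. Then $w(G-S)=\alpha(G)$.
   Context: All graphs are finite and simple. A cutset of $G$ is a set $S\subseteq V(G)$ with $G-S$ disconnected; $w(G-S)$ is the number of components of $G-S$. $G$ is $t$-tough if $|S|\ge t\cdot w(G-S)$ for every cutset $S$; for noncomplete $G$, $\tau(G)$ is the largest such $t$. A tough set of a noncomplete graph $G$ is a cutset $S$ with $|S|/w(G-S)=\tau(G)$. $\alpha(G)$ is the independence number. $R$-free means no induced copy of $R$; $P_{3}\cup P_{1}$ is the disjoint union of a path on three vertices and an isolated vertex. -}

module Defs where

open import Data.Nat using (ℕ; _≤_; _*_)
open import Data.Fin using (Fin)
open import Data.Fin.Subset using (Subset; _∈_; _∉_; ∣_∣)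
open import Data.Bool using (Bool; true; false)
open import Data.Product using (Σ; ∃; _×_)
open import Relation.Nullary using (¬_)
open import Relation.Binary.PropositionalEquality using (_≡_)
open import Function.Bundles using (_⇔_)

record Graph (n : ℕ) : Set where
  field
    adj   : Fin n → Fin n → Bool
    sym   : ∀ u v → adj u v ≡ adj v u
    irrefl : ∀ v → adj v v ≡ false
open Graph public

Adj : ∀ {n} → Graph n → Fin n → Fin n → Set
Adj G u v = adj G u v ≡ true

data Reach {n} (G : Graph n) (S : Subset n) : Fin n → Fin n → Set where
  here : ∀ {v} → v ∉ S → Reach G S v v
  step : ∀ {u v w} → u ∉ S → Adj G u v → Reach G S v w → Reach G S u w

-- w(G - S) = k : the vertices of G - S are partitioned by a surjective
-- labelling into exactly k classes, which are the connected components.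
record NumComponents {n} (G : Graph n) (S : Subset n) (k : ℕ) : Set where
  field
    label  : (v : Fin n) → v ∉ S → Fin k
    onto   : ∀ (i : Fin k) → Σ (Fin n) λ v → Σ (v ∉ S) λ p → label v p ≡ i
    classes : ∀ u v (pu : u ∉ S) (pv : v ∉ S) →
              (label u pu ≡ label v pv) ⇔ Reach G S u v

Cutset : ∀ {n} → Graph n → Subset n → ℕ → Set
Cutset G S k = NumComponents G S k × 2 ≤ k

-- S is a tough set: a cutset (with w(G-S) = k) minimising |S| / w(G-S)
-- over all cutsets, i.e. |S|/k = τ(G)  (cross-multiplied).
ToughSet : ∀ {n} → Graph n → Subset n → ℕ → Set
ToughSet {n} G S k = Cutset G S k ×
  (∀ (T : Subset n) → ∀ m → Cutset G T m → ∣ S ∣ * m ≤ ∣ T ∣ * k)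

Independent : ∀ {n} → Graph n → Subset n → Set
Independent G I = ∀ u v → u ∈ I → v ∈ I → ¬ Adj G u v

IndependenceNumber : ∀ {n} → Graph n → ℕ → Set
IndependenceNumber {n} G a =
  (Σ (Subset n) λ I → Independent G I × ∣ I ∣ ≡ a) ×
  (∀ (I : Subset n) → Independent G I → ∣ I ∣ ≤ a)

-- Induced copy of P3 ∪ P1: distinct a,b,c,d with a-b, b-c edges, a,c
-- nonadjacent, and d nonadjacent to a, b, c.
P3∪P1-free : ∀ {n} → Graph n → Set
P3∪P1-free {n} G = ∀ (a b c d : Fin n) →
  ¬ (¬ a ≡ c × ¬ d ≡ a × ¬ d ≡ b × ¬ d ≡ c ×
     Adj G a b × Adj G b c × ¬ Adj G a c ×
     ¬ Adj G d a × ¬ Adj G d b × ¬ Adj G d c)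

-- Components of G − S are cliques: a vertex d in another component would be the isolated vertex of an
-- induced P₃ ∪ P₁. Picking one vertex per component gives α(G) ≥ w(G − S). Conversely, let I be
-- independent with |I| > w(G − S) and put T = S ∖ I. Two vertices of I ∖ S cannot be joined in
-- G − T: a path leaving the component of one of them enters S ∩ I through a neighbour u, and the
-- S-vertex, u and the start vertex form an induced P₃ avoiding the other one. So
-- w(G − T) ≥ |I ∖ S|, and toughness |S| w(G − T) ≤ |T| w(G − S) together with |S| ≤ w(G − S)
-- contradicts |I| > w(G − S). The one case where T is not evidently a cutset, |I ∖ S| ≤ 1, forces
-- S ⊆ I and |S| ≥ 2, and then a component of G − S meeting I has no neighbour in S at all.
module Submission where

open import Defs
open import Data.Nat using (ℕ; zero; suc; _+_; _*_; _≤_; _<_; s≤s; z≤n; _≤?_)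
open import Data.Nat.Properties
  using ( +-suc; +-comm; +-identityʳ; *-suc; *-comm; *-distribˡ-+; *-distribʳ-+
        ; +-monoʳ-≤; +-monoˡ-≤; *-monoʳ-≤; *-monoˡ-≤; +-cancelʳ-≤; +-cancelˡ-≤
        ; ≤-reflexive; ≤-trans; ≤-antisym; ≤-pred; <-irrefl; m≤m+n; n≤0⇒n≡0; n≢0⇒n>0
        ; ≰⇒>; ≮⇒≥; module ≤-Reasoning)
open import Data.Fin using (Fin; zero; suc; fromℕ<; punchIn)
open import Data.Fin.Properties using (suc-injective; punchInᵢ≢i; injective⇒≤; any?; _≟_)
open import Data.Fin.Subset using (Subset; _∈_; _∉_; _⊆_; _∩_; _─_; ∣_∣; inside; outside)
open import Data.Fin.Subset.Properties using (_∈?_; p─q⊆p; x∈p∧x∉q⇒x∈p─q; ∩-comm)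
open import Data.Bool using (true; false)
open import Data.Bool.Properties using (T-≡)
open import Data.Vec using (_∷_; []; here; there; tabulate)
open import Data.Vec.Properties using (lookup∘tabulate; []=⇒lookup; lookup⇒[]=)
open import Data.Product using (∃; Σ; _×_; _,_; proj₁; proj₂)
open import Data.Sum using (_⊎_; inj₁; inj₂)
open import Data.Empty using (⊥; ⊥-elim)
open import Relation.Nullary using (¬_; Dec; yes; no)
open import Relation.Nullary.Decidable using (isYes; toWitness; fromWitness; _×-dec_; ¬¬-excluded-middle)
open import Relation.Binary.Core using (Rel)
open import Relation.Binary.Definitions using (Decidable)
open import Relation.Binary.Structures using (IsPartialEquivalence)
open import Relation.Binary.PropositionalEquality as ≡ using (_≡_; _≢_; refl; trans; subst; cong)
open import Function.Base using (_∘_)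
open import Function.Bundles using (_⇔_; mk⇔; Equivalence)
open import Function.Definitions using (Injective)
open import Level using (0ℓ)

open Equivalence using (to; from)

∣p∣≡∣p∩q∣+∣p─q∣ : ∀ {n} (p q : Subset n) → ∣ p ∣ ≡ ∣ p ∩ q ∣ + ∣ p ─ q ∣
∣p∣≡∣p∩q∣+∣p─q∣ []          []          = refl
∣p∣≡∣p∩q∣+∣p─q∣ (true ∷ p)  (true ∷ q)  = cong suc (∣p∣≡∣p∩q∣+∣p─q∣ p q)
∣p∣≡∣p∩q∣+∣p─q∣ (true ∷ p)  (false ∷ q) = trans (cong suc (∣p∣≡∣p∩q∣+∣p─q∣ p q)) (≡.sym (+-suc _ _))
∣p∣≡∣p∩q∣+∣p─q∣ (false ∷ p) (true ∷ q)  = ∣p∣≡∣p∩q∣+∣p─q∣ p q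
∣p∣≡∣p∩q∣+∣p─q∣ (false ∷ p) (false ∷ q) = ∣p∣≡∣p∩q∣+∣p─q∣ p q

x∈p─q⇒x∉q : ∀ {n} (p q : Subset n) {x} → x ∈ p ─ q → x ∉ q
x∈p─q⇒x∉q (_ ∷ p) (inside  ∷ q) (there x∈p─q) (there x∈q) = x∈p─q⇒x∉q p q x∈p─q x∈q
x∈p─q⇒x∉q (_ ∷ p) (outside ∷ q) (there x∈p─q) (there x∈q) = x∈p─q⇒x∉q p q x∈p─q x∈q

enum : ∀ {n} (p : Subset n) → Fin ∣ p ∣ → Fin n
enum (true ∷ p)  zero    = zero
enum (true ∷ p)  (suc i) = suc (enum p i)
enum (false ∷ p) i       = suc (enum p i)

enum-∈ : ∀ {n} (p : Subset n) i → enum p i ∈ p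
enum-∈ (true ∷ p)  zero    = here
enum-∈ (true ∷ p)  (suc i) = there (enum-∈ p i)
enum-∈ (false ∷ p) i       = there (enum-∈ p i)

enum-injective : ∀ {n} (p : Subset n) → Injective _≡_ _≡_ (enum p)
enum-injective (true ∷ p)  {zero}  {zero}  _  = refl
enum-injective (true ∷ p)  {suc i} {suc j} eq = cong suc (enum-injective p (suc-injective eq))
enum-injective (false ∷ p)                 eq = enum-injective p (suc-injective eq)

index : ∀ {n} {p : Subset n} {x} → x ∈ p → Fin ∣ p ∣
index {p = true ∷ p}  here      = zero
index {p = true ∷ p}  (there m) = suc (index m)
index {p = false ∷ p} (there m) = index m

enum-index : ∀ {n} {p : Subset n} {x} (x∈p : x ∈ p) → enum p (index x∈p) ≡ x
enum-index {p = true ∷ p}  here      = refl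
enum-index {p = true ∷ p}  (there m) = cong suc (enum-index m)
enum-index {p = false ∷ p} (there m) = cong suc (enum-index m)

∣p∣≤-injection : ∀ {n m} (p : Subset n) (f : ∀ {x} → x ∈ p → Fin m) →
  (∀ {x y} (x∈p : x ∈ p) (y∈p : y ∈ p) → f x∈p ≡ f y∈p → x ≡ y) → ∣ p ∣ ≤ m
∣p∣≤-injection p f f-inj =
  injective⇒≤ (λ eq → enum-injective p (f-inj (enum-∈ p _) (enum-∈ p _) eq))

injection≤∣p∣ : ∀ {n k} (p : Subset n) (g : Fin k → Fin n) → Injective _≡_ _≡_ g →
  (∀ i → g i ∈ p) → k ≤ ∣ p ∣
injection≤∣p∣ p g g-inj g∈p = injective⇒≤ λ {i} {j} eq →
  g-inj (trans (≡.sym (enum-index (g∈p i))) (trans (cong (enum p) eq) (enum-index (g∈p j))))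

∣p∣≡0⇒x∉p : ∀ {n} {p : Subset n} {x} → ∣ p ∣ ≡ 0 → x ∉ p
∣p∣≡0⇒x∉p eq x∈p with subst Fin eq (index x∈p)
... | ()

nonempty-element : ∀ {n} (p : Subset n) → 0 < ∣ p ∣ → ∃ λ x → x ∈ p
nonempty-element p 0<∣p∣ = enum p (fromℕ< 0<∣p∣) , enum-∈ p _

another : ∀ {k} → 2 ≤ k → (i : Fin k) → ∃ λ j → j ≢ i
another (s≤s (s≤s _)) i = punchIn i zero , punchInᵢ≢i i zero

another-element : ∀ {n} (p : Subset n) → 2 ≤ ∣ p ∣ → ∀ {x} → x ∈ p → ∃ λ y → y ∈ p × y ≢ x
another-element p 2≤∣p∣ x∈p with another 2≤∣p∣ (index x∈p)
... | j , j≢i = enum p j , enum-∈ p j , λ eq → j≢i (enum-injective p (trans eq (≡.sym (enum-index x∈p))))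

image : ∀ {n k} → (Fin k → Fin n) → Subset n
image g = tabulate λ v → isYes (any? λ i → g i ≟ v)

∈-image⁺ : ∀ {n k} (g : Fin k → Fin n) i → g i ∈ image g
∈-image⁺ g i = lookup⇒[]= (g i) (image g)
  (trans (lookup∘tabulate _ (g i)) (to T-≡ (fromWitness (i , refl))))

∈-image⁻ : ∀ {n k} (g : Fin k → Fin n) {v} → v ∈ image g → ∃ λ i → g i ≡ v
∈-image⁻ g {v} v∈ = toWitness (from T-≡ (trans (≡.sym (lookup∘tabulate _ v)) ([]=⇒lookup v∈)))

distinct⇒2≤ : ∀ {k} {i j : Fin k} → i ≢ j → 2 ≤ k
distinct⇒2≤ {suc zero}    {zero} {zero} i≢j = ⊥-elim (i≢j refl)
distinct⇒2≤ {suc (suc k)}                _   = s≤s (s≤s z≤n)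

∣p─q∣≡0⇒p⊆q : ∀ {n} (p q : Subset n) → ∣ p ─ q ∣ ≡ 0 → p ⊆ q
∣p─q∣≡0⇒p⊆q p q eq {x} x∈p with x ∈? q
... | yes x∈q = x∈q
... | no  x∉q = ⊥-elim (∣p∣≡0⇒x∉p eq (x∈p∧x∉q⇒x∈p─q x∈p x∉q))

¬¬-∀-Fin : ∀ {n} {P : Fin n → Set} → (∀ i → ¬ ¬ P i) → ¬ ¬ (∀ i → P i)
¬¬-∀-Fin {zero}  _   ¬∀ = ¬∀ λ ()
¬¬-∀-Fin {suc n} ¬¬P ¬∀ =
  ¬¬P zero λ P0 → ¬¬-∀-Fin (¬¬P ∘ suc) λ P+ → ¬∀ λ { zero → P0 ; (suc i) → P+ i }

-- NumComponents G S k is Quotient (_∉ S) (Reach G S) k. The general form is needed because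
-- restricting to the vertices suc v is not a restriction of the graph: paths may pass through zero.
record Quotient {n} (P : Fin n → Set) (R : Rel (Fin n) 0ℓ) (k : ℕ) : Set where
  field
    label   : ∀ v → P v → Fin k
    onto    : ∀ i → Σ (Fin n) λ v → Σ (P v) λ pv → label v pv ≡ i
    classes : ∀ u v (pu : P u) (pv : P v) → (label u pu ≡ label v pv) ⇔ R u v

module _ {n} {P : Fin (suc n) → Set} {R : Rel (Fin (suc n)) 0ℓ} {k}
         (q : Quotient (P ∘ suc) (λ u v → R (suc u) (suc v)) k) where
  open Quotient q

  quotient-skip : ¬ P zero → Quotient P R k
  quotient-skip ¬P0 = record { label = label′ ; onto = onto′ ; classes = classes′ }
    where
    label′ : ∀ v → P v → Fin k
    label′ zero    p0 = ⊥-elim (¬P0 p0)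
    label′ (suc v) pv = label v pv
    onto′ : ∀ i → Σ _ λ v → Σ (P v) λ pv → label′ v pv ≡ i
    onto′ i with onto i
    ... | v , pv , eq = suc v , pv , eq
    classes′ : ∀ u v (pu : P u) (pv : P v) → (label′ u pu ≡ label′ v pv) ⇔ R u v
    classes′ zero    _       p0 _  = ⊥-elim (¬P0 p0)
    classes′ (suc u) zero    _  p0 = ⊥-elim (¬P0 p0)
    classes′ (suc u) (suc v) pu pv = classes u v pu pv

  module _ (R-refl : ∀ {v} → P v → R v v) (R-equiv : IsPartialEquivalence R) (p0 : P zero) where
    open IsPartialEquivalence R-equiv renaming (sym to R-sym; trans to R-trans)

    quotient-join : ∀ v₀ → P (suc v₀) → R zero (suc v₀) → Quotient P R k
    quotient-join v₀ pv₀ r₀ = record { label = label′ ; onto = onto′ ; classes = classes′ }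
      where
      label′ : ∀ v → P v → Fin k
      label′ zero    _  = label v₀ pv₀
      label′ (suc v) pv = label v pv
      onto′ : ∀ i → Σ _ λ v → Σ (P v) λ pv → label′ v pv ≡ i
      onto′ i with onto i
      ... | v , pv , eq = suc v , pv , eq
      joined : ∀ v (pv : P (suc v)) → (label v₀ pv₀ ≡ label v pv) ⇔ R zero (suc v)
      joined v pv = mk⇔ (λ eq → R-trans r₀ (to (classes v₀ v pv₀ pv) eq))
                        (λ r → from (classes v₀ v pv₀ pv) (R-trans (R-sym r₀) r))
      classes′ : ∀ u v (pu : P u) (pv : P v) → (label′ u pu ≡ label′ v pv) ⇔ R u v
      classes′ zero    zero    pu _  = mk⇔ (λ _ → R-refl pu) (λ _ → refl)
      classes′ zero    (suc v) _  pv = joined v pv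
      classes′ (suc u) zero    pu _  = mk⇔ (R-sym ∘ to (joined u pu) ∘ ≡.sym) (≡.sym ∘ from (joined u pu) ∘ R-sym)
      classes′ (suc u) (suc v) pu pv = classes u v pu pv

    quotient-new : (∀ v → P (suc v) → ¬ R zero (suc v)) → Quotient P R (suc k)
    quotient-new alone = record { label = label′ ; onto = onto′ ; classes = classes′ }
      where
      label′ : ∀ v → P v → Fin (suc k)
      label′ zero    _  = zero
      label′ (suc v) pv = suc (label v pv)
      onto′ : ∀ i → Σ _ λ v → Σ (P v) λ pv → label′ v pv ≡ i
      onto′ zero = zero , p0 , refl
      onto′ (suc i) with onto i
      ... | v , pv , eq = suc v , pv , cong suc eq
      classes′ : ∀ u v (pu : P u) (pv : P v) → (label′ u pu ≡ label′ v pv) ⇔ R u v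
      classes′ zero    zero    pu _  = mk⇔ (λ _ → R-refl pu) (λ _ → refl)
      classes′ zero    (suc v) _  pv = mk⇔ (λ ()) (λ r → ⊥-elim (alone v pv r))
      classes′ (suc u) zero    pu _  = mk⇔ (λ ()) (λ r → ⊥-elim (alone u pu (R-sym r)))
      classes′ (suc u) (suc v) pu pv =
        mk⇔ (to (classes u v pu pv) ∘ suc-injective) (cong suc ∘ from (classes u v pu pv))

quotient : ∀ {n} {P : Fin n → Set} {R : Rel (Fin n) 0ℓ} →
  (∀ v → Dec (P v)) → Decidable R → (∀ {v} → P v → R v v) → IsPartialEquivalence R →
  ∃ (Quotient P R)
quotient {zero} _ _ _ _ = 0 , record { label = λ () ; onto = λ () ; classes = λ () }
quotient {suc n} {P} {R} P? R? R-refl R-equiv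
  with quotient (P? ∘ suc) (λ u v → R? (suc u) (suc v)) R-refl
         (record { sym = R-sym ; trans = R-trans })
  where open IsPartialEquivalence R-equiv renaming (sym to R-sym; trans to R-trans)
... | k , q with P? zero
...   | no ¬P0 = k , quotient-skip q ¬P0
...   | yes p0 with any? (λ v → P? (suc v) ×-dec R? zero (suc v))
...     | yes (v₀ , pv₀ , r₀) = k , quotient-join q R-refl R-equiv p0 v₀ pv₀ r₀
...     | no none = suc k , quotient-new q R-refl R-equiv p0 λ v pv r → none (v , pv , r)

excess-violates-toughness : ∀ {s j t c m k} → s ≡ j + t → k < j + c → c ≤ m →
  s * m ≤ t * k → s ≤ k → 0 < s → ⊥
excess-violates-toughness {s} {j} {t} {c} {m} {k} refl k<j+c c≤m sm≤tk s≤k 0<s =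
  <-irrefl refl (≤-trans 0<s (+-cancelʳ-≤ (s * k) s 0 s+sk≤sk))
  where
  open ≤-Reasoning
  s+sk≤sk : s + s * k ≤ 0 + s * k
  s+sk≤sk = begin
    s + s * k          ≡⟨ *-suc s k ⟨
    s * suc k          ≤⟨ *-monoʳ-≤ s k<j+c ⟩
    s * (j + c)        ≡⟨ *-distribˡ-+ s j c ⟩
    s * j + s * c      ≤⟨ +-monoʳ-≤ (s * j) (≤-trans (*-monoʳ-≤ s c≤m) sm≤tk) ⟩
    s * j + t * k      ≤⟨ +-monoˡ-≤ (t * k) (*-monoˡ-≤ j s≤k) ⟩
    k * j + t * k      ≡⟨ cong (_+ t * k) (*-comm k j) ⟩
    j * k + t * k      ≡⟨ *-distribʳ-+ k j t ⟨
    s * k              ∎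

small-excess : ∀ {s j t c k} → s ≡ j + t → k < j + c → c ≤ 1 → s ≤ k →
  t ≡ 0 × 0 < c × k ≤ s
small-excess {s} {j} {t} {c} {k} refl k<j+c c≤1 s≤k = t≡0 , 0<c , ≤-trans k≤j (m≤m+n j t)
  where
  k≤j : k ≤ j
  k≤j = ≤-pred (≤-trans k<j+c (≤-trans (+-monoʳ-≤ j c≤1) (≤-reflexive (+-comm j 1))))
  t≡0 : t ≡ 0
  t≡0 = n≤0⇒n≡0 (+-cancelˡ-≤ j t 0 (≤-trans s≤k (≤-trans k≤j (≤-reflexive (≡.sym (+-identityʳ j))))))
  0<c : 0 < c
  0<c = n≢0⇒n>0 λ { refl → <-irrefl refl
          (≤-trans k<j+c (≤-trans (≤-reflexive (+-identityʳ j)) (≤-trans (m≤m+n j t) s≤k))) }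


module _ {n} (G : Graph n) where

  Adj? : ∀ u v → Dec (Adj G u v)
  Adj? u v with adj G u v
  ... | true  = yes refl
  ... | false = no λ ()

  Adj-sym : ∀ {u v} → Adj G u v → Adj G v u
  Adj-sym {u} {v} a = trans (Graph.sym G v u) a

  Adj-irrefl : ∀ {v} → ¬ Adj G v v
  Adj-irrefl {v} a with trans (≡.sym a) (irrefl G v)
  ... | ()

  no-induced-P3∪P1 : P3∪P1-free G → ∀ {a b c d} → a ≢ c →
    Adj G a b → Adj G b c → ¬ Adj G a c → ¬ Adj G d a → ¬ Adj G d b → ¬ Adj G d c → ⊥
  no-induced-P3∪P1 free {a} {b} {c} {d} a≢c ab bc ¬ac ¬da ¬db ¬dc =
    free a b c d (a≢c , d≢a , d≢b , d≢c , ab , bc , ¬ac , ¬da , ¬db , ¬dc)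
    where
    d≢a : d ≢ a
    d≢a refl = ¬db ab
    d≢b : d ≢ b
    d≢b refl = ¬da (Adj-sym ab)
    d≢c : d ≢ c
    d≢c refl = ¬db (Adj-sym bc)

  module _ {S : Subset n} where

    Reach-∉ˡ : ∀ {u v} → Reach G S u v → u ∉ S
    Reach-∉ˡ (here u∉S)     = u∉S
    Reach-∉ˡ (step u∉S _ _) = u∉S

    Reach-∉ʳ : ∀ {u v} → Reach G S u v → v ∉ S
    Reach-∉ʳ (here v∉S)   = v∉S
    Reach-∉ʳ (step _ _ r) = Reach-∉ʳ r

    Reach-trans : ∀ {u v w} → Reach G S u v → Reach G S v w → Reach G S u w
    Reach-trans (here _)       r′ = r′
    Reach-trans (step u∉S a r) r′ = step u∉S a (Reach-trans r r′)

    Reach-sym : ∀ {u v} → Reach G S u v → Reach G S v u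
    Reach-sym (here v∉S)     = here v∉S
    Reach-sym (step u∉S a r) =
      Reach-trans (Reach-sym r) (step (Reach-∉ˡ r) (Adj-sym a) (here u∉S))

    Reach-closed : (Q : Fin n → Set) →
      (∀ {u v} → Q u → u ∉ S → Adj G u v → v ∉ S → Q v) →
      ∀ {u w} → Q u → Reach G S u w → Q w
    Reach-closed Q step-closed qu (here _)       = qu
    Reach-closed Q step-closed qu (step u∉S a r) =
      Reach-closed Q step-closed (step-closed qu u∉S a (Reach-∉ˡ r)) r

    Reach-clique : P3∪P1-free G → ∀ {u v d} → Reach G S u v → d ∉ S → ¬ Reach G S u d →
      u ≡ v ⊎ Adj G u v
    Reach-clique free (here _) _ _ = inj₁ refl
    Reach-clique free {u} {v} {d} (step {v = u′} u∉S uu′ r) d∉S ¬ud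
      with Reach-clique free r d∉S (¬ud ∘ step u∉S uu′)
    ... | inj₁ refl = inj₂ uu′
    ... | inj₂ u′v with u ≟ v | Adj? u v
    ...   | yes u≡v | _       = inj₁ u≡v
    ...   | no _    | yes uv  = inj₂ uv
    ...   | no u≢v  | no ¬uv  = ⊥-elim (no-induced-P3∪P1 free u≢v uu′ u′v ¬uv
            (λ du → ¬ud (step u∉S (Adj-sym du) (here d∉S)))
            (λ du′ → ¬ud (step u∉S uu′ (step (Reach-∉ˡ r) (Adj-sym du′) (here d∉S))))
            (λ dv → ¬ud (Reach-trans (step u∉S uu′ r) (step (Reach-∉ʳ r) (Adj-sym dv) (here d∉S)))))

    -- Reachability is only decidable here under double negation; that suffices since
    -- component counts of other cutsets are used only to refute something.
    ¬¬numComponents : ¬ ¬ ∃ (NumComponents G S)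
    ¬¬numComponents ¬∃ =
      ¬¬-∀-Fin (λ u → ¬¬-∀-Fin λ v → ¬¬-excluded-middle {A = Reach G S u v}) λ Reach? →
      let m , q = quotient ∉S? Reach? here (record { sym = Reach-sym ; trans = Reach-trans })
          open Quotient q
      in ¬∃ (m , record { label = label ; onto = onto ; classes = classes })
      where
      ∉S? : ∀ v → Dec (v ∉ S)
      ∉S? v with v ∈? S
      ... | yes v∈S = no λ v∉S → v∉S v∈S
      ... | no v∉S  = yes v∉S

module Components {n} {G : Graph n} {S : Subset n} {k} (cS : NumComponents G S k) where
  open NumComponents cS

  label⇒Reach : ∀ {u v} pu pv → label u pu ≡ label v pv → Reach G S u v
  label⇒Reach pu pv = to (classes _ _ pu pv)

  Reach⇒label : ∀ {u v} pu pv → Reach G S u v → label u pu ≡ label v pv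
  Reach⇒label pu pv = from (classes _ _ pu pv)

  label-irrelevant : ∀ {u} (pu pu′ : u ∉ S) → label u pu ≡ label u pu′
  label-irrelevant pu pu′ = Reach⇒label pu pu′ (here pu)

  Adj⇒label : ∀ {u v} pu pv → Adj G u v → label u pu ≡ label v pv
  Adj⇒label pu pv a = Reach⇒label pu pv (step pu a (here pv))

  components≤α : ∀ {a} → IndependenceNumber G a → k ≤ a
  components≤α (_ , maximal) =
    ≤-trans (injection≤∣p∣ (image rep) rep rep-injective (∈-image⁺ rep))
            (maximal (image rep) image-independent)
    where
    rep : Fin k → Fin n
    rep i = proj₁ (onto i)
    rep∉S : ∀ i → rep i ∉ S
    rep∉S i = proj₁ (proj₂ (onto i))
    label-rep : ∀ i → label (rep i) (rep∉S i) ≡ i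
    label-rep i = proj₂ (proj₂ (onto i))
    rep-injective : ∀ {i j} → rep i ≡ rep j → i ≡ j
    rep-injective {i} {j} eq = trans (≡.sym (label-rep i))
      (trans (Reach⇒label _ _ (subst (Reach G S (rep i)) eq (here (rep∉S i)))) (label-rep j))
    image-independent : Independent G (image rep)
    image-independent u v u∈ v∈ a with ∈-image⁻ rep u∈ | ∈-image⁻ rep v∈
    ... | i , refl | j , refl
      with trans (≡.sym (label-rep i)) (trans (Adj⇒label _ _ a) (label-rep j))
    ... | refl = Adj-irrefl G a

  component-closed : ∀ {T z w} (pz : z ∉ S) →
    (∀ {x u} (pu : u ∉ S) → x ∈ S → label u pu ≡ label z pz → ¬ Adj G u x) →
    Reach G T z w → Σ (w ∉ S) λ pw → label w pw ≡ label z pz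
  component-closed {T} {z} pz no-exit = Reach-closed G Q closed (pz , refl)
    where
    Q : Fin n → Set
    Q w = Σ (w ∉ S) λ pw → label w pw ≡ label z pz
    closed : ∀ {u v} → Q u → u ∉ T → Adj G u v → v ∉ T → Q v
    closed {u} {v} (pu , eq) _ a _ with v ∈? S
    ... | yes v∈S = ⊥-elim (no-exit pu v∈S eq a)
    ... | no  pv  = pv , trans (≡.sym (Adj⇒label pu pv a)) eq

  module _ (2≤k : 2 ≤ k) where

    outside-component : ∀ {u} pu → ∃ λ d → Σ (d ∉ S) λ pd → label d pd ≢ label u pu
    outside-component {u} pu with another 2≤k (label u pu)
    ... | i , i≢ with onto i
    ... | d , pd , refl = d , pd , i≢

    component-clique : P3∪P1-free G → ∀ {u v} pu pv → label u pu ≡ label v pv →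
      u ≡ v ⊎ Adj G u v
    component-clique free pu pv eq with outside-component pu
    ... | d , pd , d≁u = Reach-clique G free (label⇒Reach pu pv eq) pd
            (d≁u ∘ ≡.sym ∘ Reach⇒label pu pd)

    independent-meets-component-once : P3∪P1-free G → ∀ {I} → Independent G I →
      ∀ {u v} pu pv → u ∈ I → v ∈ I → label u pu ≡ label v pv → u ≡ v
    independent-meets-component-once free indI pu pv u∈I v∈I eq
      with component-clique free pu pv eq
    ... | inj₁ u≡v = u≡v
    ... | inj₂ uv  = ⊥-elim (indI _ _ u∈I v∈I uv)

module IndependentSetCut {n} {G : Graph n} (free : P3∪P1-free G)
  {S : Subset n} {k} (cS : NumComponents G S k) (2≤k : 2 ≤ k)
  {I : Subset n} (indI : Independent G I) where
  open NumComponents cS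
  open Components cS

  T : Subset n
  T = S ─ I

  ∉S⇒∉T : ∀ {v} → v ∉ S → v ∉ T
  ∉S⇒∉T v∉S v∈T = v∉S (p─q⊆p S I v∈T)

  ∈S─T⇒∈I : ∀ {v} → v ∈ S → v ∉ T → v ∈ I
  ∈S─T⇒∈I {v} v∈S v∉T with v ∈? I
  ... | yes v∈I = v∈I
  ... | no  v∉I = ⊥-elim (v∉T (x∈p∧x∉q⇒x∈p─q v∈S v∉I))

  I─S-separated : ∀ {z z′} → z ∈ I ─ S → z′ ∈ I ─ S → Reach G T z z′ → z ≡ z′
  I─S-separated {z} {z′} z∈ z′∈ r with z ≟ z′
  ... | yes z≡z′ = z≡z′
  ... | no  z≢z′ = ⊥-elim (z≁z′ (trans (≡.sym (proj₂ reached)) (label-irrelevant _ _)))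
    where
    z∈I : z ∈ I
    z∈I = p─q⊆p I S z∈
    z′∈I : z′ ∈ I
    z′∈I = p─q⊆p I S z′∈
    pz : z ∉ S
    pz = x∈p─q⇒x∉q I S z∈
    pz′ : z′ ∉ S
    pz′ = x∈p─q⇒x∉q I S z′∈
    z≁z′ : label z pz ≢ label z′ pz′
    z≁z′ = z≢z′ ∘ independent-meets-component-once 2≤k free indI pz pz′ z∈I z′∈I
    Q : Fin n → Set
    Q w = Σ (w ∉ S) λ pw → label w pw ≡ label z pz
    closed : ∀ {u v} → Q u → u ∉ T → Adj G u v → v ∉ T → Q v
    closed {u} {v} (pu , u~z) _ uv v∉T with v ∈? S
    ... | no  pv  = pv , trans (≡.sym (Adj⇒label pu pv uv)) u~z
    ... | yes v∈S with ∈S─T⇒∈I v∈S v∉T | component-clique 2≤k free pu pz u~z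
    ...   | v∈I | inj₁ refl = ⊥-elim (indI _ _ z∈I v∈I uv)
    ...   | v∈I | inj₂ uz   = ⊥-elim (no-induced-P3∪P1 G free (λ { refl → pz v∈S })
              (Adj-sym G uv) uz (indI _ _ v∈I z∈I) (indI _ _ z′∈I v∈I)
              (λ z′u → z≁z′ (≡.sym (trans (Adj⇒label pz′ pu z′u) u~z)))
              (indI _ _ z′∈I z∈I))
    reached : Q z′
    reached = Reach-closed G Q closed (pz , refl) r

  I─S≤components : ∀ {m} → NumComponents G T m → ∣ I ─ S ∣ ≤ m
  I─S≤components cT = ∣p∣≤-injection (I ─ S)
    (λ z∈ → NumComponents.label cT _ (∉S⇒∉T (x∈p─q⇒x∉q I S z∈)))
    (λ z∈ z′∈ eq → I─S-separated z∈ z′∈ (Components.label⇒Reach cT _ _ eq))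

  ∣I∣≡∣S∩I∣+∣I─S∣ : ∣ I ∣ ≡ ∣ S ∩ I ∣ + ∣ I ─ S ∣
  ∣I∣≡∣S∩I∣+∣I─S∣ = trans (∣p∣≡∣p∩q∣+∣p─q∣ I S) (cong (λ r → ∣ r ∣ + ∣ I ─ S ∣) (∩-comm I S))

  module _ (S⊆I : S ⊆ I) (2≤∣S∣ : 2 ≤ ∣ S ∣) {z} (z∈I : z ∈ I) (pz : z ∉ S) where

    -- Given an edge u x with u ~ z, another y ∈ S and p in another component: the induced P₃'s
    -- x u z and w u z (for w ∈ S adjacent to u) force y ~ u and p ~ w, so x p y is an induced P₃ missing z.
    component-without-exit : ∀ {x u} (pu : u ∉ S) → x ∈ S → label u pu ≡ label z pz → ¬ Adj G u x
    component-without-exit {x} {u} pu x∈S u~z ux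
      with component-clique 2≤k free pu pz u~z | another-element S 2≤∣S∣ x∈S | outside-component 2≤k pz
    ... | inj₁ refl | _ | _ = indI _ _ z∈I (S⊆I x∈S) ux
    ... | inj₂ uz | y , y∈S , y≢x | p , pp , p≁z =
      no-induced-P3∪P1 G free (y≢x ∘ ≡.sym)
        (Adj-sym G (p~ x∈S (Adj-sym G ux))) (p~ y∈S y~u)
        (indI _ _ (S⊆I x∈S) (S⊆I y∈S))
        (indI _ _ z∈I (S⊆I x∈S)) (p≁z ∘ ≡.sym ∘ Adj⇒label pz pp)
        (indI _ _ z∈I (S⊆I y∈S))
      where
      ≢z : ∀ {w} → w ∈ S → w ≢ z
      ≢z w∈S refl = pz w∈S
      y~u : Adj G y u
      y~u with Adj? G y u
      ... | yes yu = yu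
      ... | no ¬yu = ⊥-elim (no-induced-P3∪P1 G free (≢z x∈S) (Adj-sym G ux) uz
              (indI _ _ (S⊆I x∈S) z∈I) (indI _ _ (S⊆I y∈S) (S⊆I x∈S)) ¬yu (indI _ _ (S⊆I y∈S) z∈I))
      p~ : ∀ {w} → w ∈ S → Adj G w u → Adj G p w
      p~ {w} w∈S wu with Adj? G p w
      ... | yes pw = pw
      ... | no ¬pw = ⊥-elim (no-induced-P3∪P1 G free (≢z w∈S) wu uz
              (indI _ _ (S⊆I w∈S) z∈I) ¬pw
              (λ pu′ → p≁z (trans (Adj⇒label pp pu pu′) u~z)) (p≁z ∘ Adj⇒label pp pz))

  S─I-disconnects : ∣ S ∣ ≤ k → k < ∣ S ∩ I ∣ + ∣ I ─ S ∣ → ∀ {m} → NumComponents G T m → 2 ≤ m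
  S─I-disconnects s≤k k<j+c cT with 2 ≤? ∣ I ─ S ∣
  ... | yes 2≤c = ≤-trans 2≤c (I─S≤components cT)
  ... | no  c≱2 with small-excess (∣p∣≡∣p∩q∣+∣p─q∣ S I) k<j+c (≤-pred (≰⇒> c≱2)) s≤k
  ...   | t≡0 , 0<c , k≤s with nonempty-element (I ─ S) 0<c
  ...     | z , z∈ with x∈p─q⇒x∉q I S z∈
  ...       | pz with outside-component 2≤k pz
  ...         | p , pp , p≁z = distinct⇒2≤ z≁p
    where
    z≁p : NumComponents.label cT z (∉S⇒∉T pz) ≢ NumComponents.label cT p (∉S⇒∉T pp)
    z≁p eq with component-closed pz
                  (component-without-exit (∣p─q∣≡0⇒p⊆q S I t≡0) (≤-trans 2≤k k≤s) (p─q⊆p I S z∈) pz)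
                  (Components.label⇒Reach cT _ _ eq)
    ... | pp′ , p~z = p≁z (trans (label-irrelevant pp pp′) p~z)

lemma2p10 : ∀ {n} (G : Graph n) → P3∪P1-free G →
    (S : Subset n) (k : ℕ) → ToughSet G S k →
    0 < ∣ S ∣ → ∣ S ∣ ≤ k →
    (a : ℕ) → IndependenceNumber G a →
    k ≡ a
lemma2p10 G free S k ((cS , 2≤k) , tough) 0<∣S∣ ∣S∣≤k a α@((I , indI , ∣I∣≡a) , _) =
  ≤-antisym (Components.components≤α cS α) (≮⇒≥ λ k<a →
    ¬¬numComponents G {S ─ I} λ (m , cT) →
      let open IndependentSetCut free cS 2≤k indI
          k<j+c = subst (k <_) (trans (≡.sym ∣I∣≡a) ∣I∣≡∣S∩I∣+∣I─S∣) k<a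
      in excess-violates-toughness (∣p∣≡∣p∩q∣+∣p─q∣ S I) k<j+c (I─S≤components cT)
           (tough (S ─ I) m (cT , S─I-disconnects ∣S∣≤k k<j+c cT)) ∣S∣≤k 0<∣S∣)
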